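{- Let $(U,\mathcal{F})$ be a set system with positive set costs $c_S$, let $f$ be the maximum number of sets of $\mathcal{F}$ containing any element, let $A \subseteq U$ be a set of active elements, and let $\beta = 32 f$. Suppose each set $S \in \mathcal{F}$ is assigned an integer level $\mathrm{level}(S) \ge b(S)$, where $b(S) = -\lceil \log_2(\beta c_S)\rceil - 1$, and suppose every set is stable (with respect to the duals defined below). Then every $e \in A$ is contained in some $S \in \mathcal{F}$ with $\mathrm{level}(S) > b(S)$.
   Context: For an active element $e \in A$, define $\mathrm{level}(e) = \max_{S \in \mathcal{F}: e \in S} \mathrm{level}(S)$ and its dual value $y(e) = 2^{ -\mathrm{level}(e)}$. For a set $S$, $y(S) = \sum_{e \in S \cap A} y(e)$. A set $S$ is stable if: when $\mathrm{level}(S) > b(S)$, $y(S) \in [c_S/\beta, \beta c_S]$; and when $\mathrm{level}(S) = b(S)$, $y(S) < \beta c_S$. Every element of $U$ lies in at least one set of $\mathcal{F}$. -}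

module Defs where

open import Data.Nat as ℕ using (ℕ; _⊔_)
import Data.Nat.Properties as ℕP
open import Data.Integer as ℤ using (ℤ; +_; -[1+_])
open import Data.Rational as ℚ using (ℚ; _<_; _≤_; _*_; _+_; 0ℚ)
open import Data.Fin using (Fin)
open import Data.Fin.Subset using (Subset; _∈_; ∣_∣)
open import Data.Vec using (tabulate; lookup)
open import Data.List using (List; foldr; allFin)
open import Data.Maybe using (Maybe; just; nothing)
open import Data.Bool using (Bool; true; false; _∧_; if_then_else_)
open import Data.Product using (_×_)

pow2 : ℤ → ℚ
pow2 (+ k) = (+ (2 ℕ.^ k)) ℚ./ 1
pow2 -[1+ k ] = (+ 1) ℚ./ (2 ℕ.^ ℕ.suc k)
  where instance _ = ℕP.m^n≢0 2 (ℕ.suc k)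

IsCeilLog2 : ℚ → ℤ → Set
IsCeilLog2 x k = (pow2 (k ℤ.- ℤ.1ℤ) < x) × (x ≤ pow2 k)

SetSystem : ℕ → ℕ → Set
SetSystem n m = Fin m → Subset n

setsContaining : ∀ {n m} → SetSystem n m → Fin n → Subset m
setsContaining F e = tabulate (λ S → lookup (F S) e)

maxFreq : ∀ {n m} → SetSystem n m → ℕ
maxFreq {n} F = foldr (λ e acc → ∣ setsContaining F e ∣ ⊔ acc) 0 (allFin n)

beta : ∀ {n m} → SetSystem n m → ℚ
beta F = (+ (32 ℕ.* maxFreq F)) ℚ./ 1

maxM : Maybe ℤ → ℤ → Maybe ℤ
maxM nothing  l = just l
maxM (just k) l = just (k ℤ.⊔ l)

-- level(e) = max over S ∋ e of level(S)  (nothing iff e lies in no set)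
levelElem : ∀ {n m} → SetSystem n m → (Fin m → ℤ) → Fin n → Maybe ℤ
levelElem {n} {m} F level e =
  foldr (λ S acc → if lookup (F S) e then maxM acc (level S) else acc) nothing (allFin m)

-- y(e) = 2^{-level(e)}   (the 'nothing' case never occurs for covered elements)
yElem : ∀ {n m} → SetSystem n m → (Fin m → ℤ) → Fin n → ℚ
yElem F level e with levelElem F level e
... | just l  = pow2 (ℤ.- l)
... | nothing = 0ℚ

ySet : ∀ {n m} → SetSystem n m → (Fin m → ℤ) → (A : Subset n) → Fin m → ℚ
ySet {n} F level A S =
  foldr (λ e acc → if lookup (F S) e ∧ lookup A e then yElem F level e + acc else acc) 0ℚ (allFin n)

-- b(S) = -⌈log₂(β c_S)⌉ - 1, where k S = ⌈log₂(β c_S)⌉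
bOf : ∀ {m} → (Fin m → ℤ) → Fin m → ℤ
bOf k S = ℤ.- (k S) ℤ.- ℤ.1ℤ

-- stability of S.  c_S/β ≤ y(S) is written c_S ≤ β·y(S) (β > 0 whenever U ≠ ∅).
Stable : ∀ {n m} → SetSystem n m → (c : Fin m → ℚ) → (level b : Fin m → ℤ)
         → (A : Subset n) → Fin m → Set
Stable F c level b A S =
  (b S ℤ.< level S → (c S ≤ beta F * ySet F level A S) × (ySet F level A S ≤ beta F * c S))
  × (level S ≡ b S → ySet F level A S < beta F * c S)
  where open import Relation.Binary.PropositionalEquality using (_≡_)

module Submission where

open import Defs
open import Data.Nat using (ℕ)
open import Data.Integer as ℤ using (ℤ)
open import Data.Rational as ℚ using (ℚ)
open import Data.Fin using (Fin)
open import Data.Fin.Subset using (Subset; _∈_)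
open import Data.Product using (Σ; _×_)

import Data.Nat as ℕ
import Data.Nat.Properties as ℕP
open import Data.Integer using (+_; -[1+_])
import Data.Integer.Properties as ℤP
import Data.Rational.Properties as ℚP
open import Data.Rational using (0ℚ)
open import Data.Rational.Unnormalised as ℚᵘ using (mkℚᵘ)
import Data.Rational.Unnormalised.Properties as ℚᵘP
open import Data.Vec using (lookup)
open import Data.Vec.Properties using ([]=⇒lookup; lookup⇒[]=)
open import Data.List using (List; []; _∷_; foldr; allFin)
open import Data.List.Relation.Unary.All as All using (All; []; _∷_)
open import Data.List.Relation.Unary.Any using (here; there)
import Data.List.Membership.Propositional as List
open import Data.List.Membership.Propositional.Properties using (∈-allFin)
open import Data.Maybe using (Maybe; just; nothing)
open import Data.Maybe.Properties using (just-injective)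
open import Data.Bool using (Bool; true; false; _∧_; if_then_else_)
open import Data.Product using (_,_; proj₂; ∃-syntax)
open import Data.Sum using (inj₁; inj₂)
open import Relation.Nullary using (contradiction)
open import Relation.Binary.PropositionalEquality

-- The dual of an active element e is 2^(-level e), where level e is attained by some S ∋ e.
-- If S sat at its base level b(S) = -⌈log₂(β c_S)⌉ - 1, then y(S) ≥ y(e) = 2^(⌈log₂(β c_S)⌉+1) ≥ β c_S,
-- contradicting the stability condition y(S) < β c_S for sets at base level.

normalize-mono-≤ : ∀ a b c d .{{_ : ℕ.NonZero b}} .{{_ : ℕ.NonZero d}} →
                   a ℕ.* d ℕ.≤ c ℕ.* b → ℚ.normalize a b ℚ.≤ ℚ.normalize c d
normalize-mono-≤ a (ℕ.suc b) c (ℕ.suc d) ad≤cb =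
  ℚP.toℚᵘ-cancel-≤
    (ℚᵘP.≤-respˡ-≃ (ℚᵘP.≃-sym (ℚP.toℚᵘ-fromℚᵘ (mkℚᵘ (+ a) b)))
      (ℚᵘP.≤-respʳ-≃ (ℚᵘP.≃-sym (ℚP.toℚᵘ-fromℚᵘ (mkℚᵘ (+ c) d)))
        (ℚᵘ.*≤* (subst₂ ℤ._≤_ (ℤP.pos-* a (ℕ.suc d)) (ℤP.pos-* c (ℕ.suc b)) (ℤ.+≤+ ad≤cb)))))

pow2-nonNeg : ∀ k → 0ℚ ℚ.≤ pow2 k
pow2-nonNeg (+ k)    = ℚP.nonNegative⁻¹ _ {{ℚP.normalize-nonNeg (2 ℕ.^ k) 1}}
pow2-nonNeg -[1+ k ] = ℚP.nonNegative⁻¹ _ {{ℚP.normalize-nonNeg 1 (2 ℕ.^ ℕ.suc k) {{ℕP.m^n≢0 2 (ℕ.suc k)}}}}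

pow2-≤-pow2-suc : ∀ k → pow2 k ℚ.≤ pow2 (k ℤ.+ ℤ.1ℤ)
pow2-≤-pow2-suc (+ n) = normalize-mono-≤ (2 ℕ.^ n) 1 (2 ℕ.^ (n ℕ.+ 1)) 1
  (subst₂ ℕ._≤_ (sym (ℕP.*-identityʳ _)) (sym (ℕP.*-identityʳ _))
    (ℕP.^-monoʳ-≤ 2 (ℕP.m≤m+n n 1)))
pow2-≤-pow2-suc -[1+ 0 ] = normalize-mono-≤ 1 2 1 1 (ℕ.s≤s ℕ.z≤n)
pow2-≤-pow2-suc -[1+ ℕ.suc n ] =
  normalize-mono-≤ 1 (2 ℕ.^ ℕ.suc (ℕ.suc n)) 1 (2 ℕ.^ ℕ.suc n)
    {{ℕP.m^n≢0 2 (ℕ.suc (ℕ.suc n))}} {{ℕP.m^n≢0 2 (ℕ.suc n)}}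
    (subst₂ ℕ._≤_ (sym (ℕP.*-identityˡ _)) (sym (ℕP.*-identityˡ _))
      (ℕP.^-monoʳ-≤ 2 (ℕP.n≤1+n (ℕ.suc n))))

neg-bOf : ∀ {m} (k : Fin m → ℤ) S → ℤ.- bOf k S ≡ k S ℤ.+ ℤ.1ℤ
neg-bOf k S = trans (ℤP.neg-distrib-+ (ℤ.- k S) (ℤ.- ℤ.1ℤ)) (cong (ℤ._+ ℤ.1ℤ) (ℤP.neg-involutive (k S)))

ceilLog2⇒≤pow2-neg-bOf : ∀ {m} {x} (k : Fin m → ℤ) S → IsCeilLog2 x (k S) → x ℚ.≤ pow2 (ℤ.- bOf k S)
ceilLog2⇒≤pow2-neg-bOf {x = x} k S (_ , x≤2^k) = begin
  x                        ≤⟨ x≤2^k ⟩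
  pow2 (k S)               ≤⟨ pow2-≤-pow2-suc (k S) ⟩
  pow2 (k S ℤ.+ ℤ.1ℤ)      ≡⟨ cong pow2 (neg-bOf k S) ⟨
  pow2 (ℤ.- bOf k S)       ∎
  where open ℚP.≤-Reasoning

-- levelElem and ySet are, definitionally, instances of maxOver and sumOver over allFin.
module MaxOver {a} {A : Set a} (p : A → Bool) (f : A → ℤ) where

  maxOver : List A → Maybe ℤ
  maxOver = foldr (λ x acc → if p x then maxM acc (f x) else acc) nothing

  maxOver-attained : ∀ xs {l} → maxOver xs ≡ just l → ∃[ x ] p x ≡ true × f x ≡ l
  maxOver-attained (x ∷ xs) eq with p x in px
  ... | false = maxOver-attained xs eq
  ... | true with maxOver xs in rest
  ...   | nothing = x , px , just-injective eq
  ...   | just k with ℤP.⊔-sel k (f x)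
  ...     | inj₂ k⊔fx≡fx = x , px , trans (sym k⊔fx≡fx) (just-injective eq)
  ...     | inj₁ k⊔fx≡k with maxOver-attained xs rest
  ...       | y , py , fy≡k = y , py , trans fy≡k (trans (sym k⊔fx≡k) (just-injective eq))

  maxOver-nothing : ∀ xs → maxOver xs ≡ nothing → All (λ x → p x ≡ false) xs
  maxOver-nothing []       _  = []
  maxOver-nothing (x ∷ xs) eq with p x in px
  ... | false = px ∷ maxOver-nothing xs eq
  ... | true with maxOver xs | eq
  ...   | nothing | ()
  ...   | just _  | ()

module SumOver {a} {A : Set a} (q : A → Bool) (g : A → ℚ) (g-nonNeg : ∀ x → 0ℚ ℚ.≤ g x) where

  sumOver : List A → ℚ
  sumOver = foldr (λ x acc → if q x then g x ℚ.+ acc else acc) 0ℚ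

  sumOver-nonNeg : ∀ xs → 0ℚ ℚ.≤ sumOver xs
  sumOver-nonNeg []       = ℚP.≤-refl
  sumOver-nonNeg (x ∷ xs) with q x
  ... | true  = ℚP.+-mono-≤ (g-nonNeg x) (sumOver-nonNeg xs)
  ... | false = sumOver-nonNeg xs

  term≤sumOver : ∀ {x} xs → x List.∈ xs → q x ≡ true → g x ℚ.≤ sumOver xs
  term≤sumOver {x} (x ∷ xs) (here refl) qx rewrite qx = begin
    g x                 ≡⟨ ℚP.+-identityʳ (g x) ⟨
    g x ℚ.+ 0ℚ          ≤⟨ ℚP.+-monoʳ-≤ (g x) (sumOver-nonNeg xs) ⟩
    g x ℚ.+ sumOver xs  ∎
    where open ℚP.≤-Reasoning
  term≤sumOver {x} (y ∷ xs) (there x∈xs) qx with q y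
  ... | false = term≤sumOver xs x∈xs qx
  ... | true  = begin
    g x                 ≡⟨ ℚP.+-identityˡ (g x) ⟨
    0ℚ ℚ.+ g x          ≤⟨ ℚP.+-mono-≤ (g-nonNeg y) (term≤sumOver xs x∈xs qx) ⟩
    g y ℚ.+ sumOver xs  ∎
    where open ℚP.≤-Reasoning

module _ {n m} (F : SetSystem n m) (level : Fin m → ℤ) where

  open MaxOver using (maxOver-attained; maxOver-nothing)

  levelElem-attained : ∀ {e l} → levelElem F level e ≡ just l → ∃[ S ] e ∈ F S × level S ≡ l
  levelElem-attained {e} eq with maxOver-attained (λ S → lookup (F S) e) level (allFin m) eq
  ... | S , e∈S , levelS≡l = S , lookup⇒[]= e (F S) e∈S , levelS≡l

  levelElem-covered : ∀ {e S} → e ∈ F S → levelElem F level e ≢ nothing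
  levelElem-covered {e} {S} e∈S eq with
    All.lookup (maxOver-nothing (λ S → lookup (F S) e) level (allFin m) eq) (∈-allFin S)
  ... | e∉S = contradiction (trans (sym ([]=⇒lookup e∈S)) e∉S) λ ()

  attaining-set : ∀ {e S} → e ∈ F S → ∃[ T ] e ∈ F T × levelElem F level e ≡ just (level T)
  attaining-set {e} e∈S with levelElem F level e in eq
  ... | nothing = contradiction eq (levelElem-covered e∈S)
  ... | just l with levelElem-attained eq
  ...   | T , e∈T , refl = T , e∈T , refl

  yElem-just : ∀ {e l} → levelElem F level e ≡ just l → yElem F level e ≡ pow2 (ℤ.- l)
  yElem-just eq rewrite eq = refl

  yElem-nonNeg : ∀ e → 0ℚ ℚ.≤ yElem F level e
  yElem-nonNeg e with levelElem F level e
  ... | just l  = pow2-nonNeg (ℤ.- l)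
  ... | nothing = ℚP.≤-refl

  yElem≤ySet : ∀ {A e S} → e ∈ F S → e ∈ A → yElem F level e ℚ.≤ ySet F level A S
  yElem≤ySet {A} {e} {S} e∈S e∈A =
    SumOver.term≤sumOver (λ x → lookup (F S) x ∧ lookup A x) (yElem F level) yElem-nonNeg
      (allFin n) (∈-allFin e) (cong₂ _∧_ ([]=⇒lookup e∈S) ([]=⇒lookup e∈A))

  attaining-set-above-base : ∀ c A k {e S} →
    IsCeilLog2 (beta F ℚ.* c S) (k S) → bOf k S ℤ.≤ level S → Stable F c level (bOf k) A S →
    e ∈ A → e ∈ F S → levelElem F level e ≡ just (level S) → bOf k S ℤ.< level S
  attaining-set-above-base c A k {e} {S} ceil b≤level (_ , base-stable) e∈A e∈S attains =
    ℤP.≤∧≢⇒< b≤level λ b≡level →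
      ℚP.<-irrefl refl (ℚP.<-≤-trans (base-stable (sym b≡level)) (βc≤ySet b≡level))
    where
    open ℚP.≤-Reasoning
    βc≤ySet : bOf k S ≡ level S → beta F ℚ.* c S ℚ.≤ ySet F level A S
    βc≤ySet b≡level = begin
      beta F ℚ.* c S          ≤⟨ ceilLog2⇒≤pow2-neg-bOf k S ceil ⟩
      pow2 (ℤ.- bOf k S)      ≡⟨ cong (λ b → pow2 (ℤ.- b)) b≡level ⟩
      pow2 (ℤ.- level S)      ≡⟨ yElem-just attains ⟨
      yElem F level e         ≤⟨ yElem≤ySet e∈S e∈A ⟩
      ySet F level A S        ∎

mainTheorem2 : ∀ {n m} (F : SetSystem n m) (c : Fin m → ℚ) (A : Subset n)
    (level : Fin m → ℤ) (k : Fin m → ℤ)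
    → (∀ S → ℚ.Positive (c S))
    → (∀ (e : Fin n) → Σ (Fin m) (λ S → e ∈ F S))
    → (∀ S → IsCeilLog2 (beta F ℚ.* c S) (k S))
    → (∀ S → bOf k S ℤ.≤ level S)
    → (∀ S → Stable F c level (bOf k) A S)
    → ∀ e → e ∈ A → Σ (Fin m) (λ S → (e ∈ F S) × (bOf k S ℤ.< level S))
mainTheorem2 F c A level k _ cover ceil b≤level stable e e∈A =
  let S , e∈S , attains = attaining-set F level (proj₂ (cover e))
  in S , e∈S , attaining-set-above-base F level c A k (ceil S) (b≤level S) (stable S) e∈A e∈S attains
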